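{- Let $d\ge1$ be a fixed integer, let $N$ be an integer, $L=\lfloor\log_2 N\rfloor$ and $\lambda=L/(12\lceil\log_2 L\rceil)$, and suppose $N$ is large enough that $\lambda^2/d^2>L$. Let $y$ be an integer in $[\lambda,L]$ which is not of the form $p\times q$ with $p$ a prime number and $q$ a positive integer with $q\le d$. Then $y$ has a divisor $y_1$ such that $d<y_1<\lambda$. -}

module Defs where

open import Data.Nat using (ℕ; _*_; _≤_; _<_)
open import Data.Nat.Logarithm using (⌊log₂_⌋; ⌈log₂_⌉)

Lof : ℕ → ℕ
Lof N = ⌊log₂ N ⌋

-- λ = L / (12 ⌈log₂ L⌉) = Lof N / den N   (a rational number; we compare by
-- cross-multiplication, den N being positive)
den : ℕ → ℕ
den N = 12 * ⌈log₂ (Lof N) ⌉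

λ≤ : ℕ → ℕ → Set
λ≤ N y = Lof N ≤ den N * y

<λ : ℕ → ℕ → Set
<λ N y = den N * y < Lof N

λ²/d²>L : ℕ → ℕ → Set
λ²/d²>L N d = Lof N * (den N * den N * (d * d)) < Lof N * Lof N

-- Take a divisor y₁ > d of y that is minimal for divisibility among such divisors: if it is
-- composite, both of its proper factors are ≤ d, so y₁ ≤ d².  Writing L = λD with D = 12⌈log₂ L⌉,
-- the hypothesis λ² > d²L reads λ > d²D, so d² < λ and such a y₁ is below λ.  Otherwise y₁ is
-- prime; if y₁ ≥ λ, the cofactor q = y / y₁ satisfies q ≤ L / λ = D < λ, and q > d because y is
-- not a prime times a positive number ≤ d.
module Submission where

open import Defs
open import Data.Nat using (ℕ; _*_; _≤_; _<_; NonZero; z≤n; _<?_; >-nonZero; >-nonZero⁻¹; n>1⇒nonTrivial; nonTrivial⇒nonZero)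
open import Data.Nat.Properties
open import Data.Nat.Divisibility using (_∣_; quotient; quotient-∣; quotient≢0; quotient-<; m∣n⇒n≡quotient*m; m∣n⇒n≡m*quotient; ∣-refl; ∣-trans)
open import Data.Nat.Primality using (Prime; Composite; composite; prime?; ¬prime⇒composite)
open import Data.Nat.Induction using (<-rec)
open import Data.Product using (Σ; _×_; ∃; _,_)
open import Data.Sum using (_⊎_; inj₁; inj₂)
open import Relation.Nullary using (¬_; yes; no)
open import Relation.Binary.PropositionalEquality using (_≡_; sym)
open import Data.Empty using (⊥-elim)

PrimeOrSmallDivisorAbove : ℕ → ℕ → Set
PrimeOrSmallDivisorAbove d z = ∃ λ y₁ → y₁ ∣ z × d < y₁ × (y₁ ≤ d * d ⊎ Prime y₁)

prime-or-small-divisor-above : ∀ {d} → 1 ≤ d → ∀ z → d < z → PrimeOrSmallDivisorAbove d z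
prime-or-small-divisor-above {d} 1≤d = <-rec _ step
  where
  step : ∀ z → (∀ {m} → m < z → d < m → PrimeOrSmallDivisorAbove d m)
       → d < z → PrimeOrSmallDivisorAbove d z
  step z rec d<z with prime? z
  ... | yes z-prime = z , ∣-refl , d<z , inj₂ z-prime
  ... | no ¬z-prime = split (¬prime⇒composite ¬z-prime)
    where
    instance
      z-nonTrivial = n>1⇒nonTrivial (≤-<-trans 1≤d d<z)
      z-nonZero = nonTrivial⇒nonZero z

    through : ∀ {m} → m ∣ z → PrimeOrSmallDivisorAbove d m → PrimeOrSmallDivisorAbove d z
    through m∣z (y₁ , y₁∣m , rest) = y₁ , ∣-trans y₁∣m m∣z , rest

    split : Composite z → PrimeOrSmallDivisorAbove d z
    split (composite {a} a<z a∣z) with d <? a | d <? quotient a∣z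
    ... | yes d<a | _       = through a∣z (rec a<z d<a)
    ... | no _    | yes d<b = through (quotient-∣ a∣z) (rec (quotient-< a∣z) d<b)
    ... | no d≮a  | no d≮b  = z , ∣-refl , d<z , inj₁ z≤d²
      where
      z≤d² : z ≤ d * d
      z≤d² = ≤-trans (≤-reflexive (m∣n⇒n≡quotient*m a∣z)) (*-mono-≤ (≮⇒≥ d≮b) (≮⇒≥ d≮a))

-- The threshold λ is L / D; D²d²<L is λ² / d² > L after clearing denominators and cancelling L.
module Threshold (d D L : ℕ) .{{_ : NonZero d}} .{{_ : NonZero D}}
                 (D²d²<L : D * D * (d * d) < L) where

  ≤d²⇒<λ : ∀ {x} → x ≤ d * d → D * x < L
  ≤d²⇒<λ {x} x≤d² = ≤-<-trans D*x≤D²d² D²d²<L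
    where
    D*x≤D²d² : D * x ≤ D * D * (d * d)
    D*x≤D²d² = ≤-trans (*-monoʳ-≤ D x≤d²) (*-monoˡ-≤ (d * d) (m≤m*n D D))

  ≤D⇒<λ : ∀ {x} → x ≤ D → D * x < L
  ≤D⇒<λ {x} x≤D = ≤-<-trans D*x≤D²d² D²d²<L
    where
    instance _ = m*n≢0 d d
    D*x≤D²d² : D * x ≤ D * D * (d * d)
    D*x≤D²d² = ≤-trans (*-monoʳ-≤ D x≤D) (m≤m*n (D * D) (d * d))

  ≥λ⇒>d : ∀ {y} → L ≤ D * y → d < y
  ≥λ⇒>d {y} L≤Dy with d <? y
  ... | yes d<y = d<y
  ... | no d≮y = ⊥-elim (≤⇒≯ L≤Dy (≤d²⇒<λ (≤-trans (≮⇒≥ d≮y) (m≤m*n d d))))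

lemma7p9 : (d N y : ℕ) → 1 ≤ d → 1 ≤ den N → λ²/d²>L N d
    → λ≤ N y → y ≤ Lof N
    → ¬ (Σ ℕ λ p → Σ ℕ λ q → Prime p × 1 ≤ q × q ≤ d × y ≡ p * q)
    → Σ ℕ λ y₁ → y₁ ∣ y × d < y₁ × <λ N y₁
lemma7p9 d N y 1≤d 1≤D λ²/d²>L λ≤y y≤L not-prime-times-small =
  below-λ (prime-or-small-divisor-above 1≤d y d<y)
  where
  instance
    d-nonZero = >-nonZero 1≤d
    D-nonZero = >-nonZero 1≤D
  open Threshold d (den N) (Lof N) (*-cancelˡ-< (Lof N) _ _ λ²/d²>L)

  d<y : d < y
  d<y = ≥λ⇒>d λ≤y

  below-λ : PrimeOrSmallDivisorAbove d y → Σ ℕ λ y₁ → y₁ ∣ y × d < y₁ × <λ N y₁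
  below-λ (y₁ , y₁∣y , d<y₁ , inj₁ y₁≤d²) = y₁ , y₁∣y , d<y₁ , ≤d²⇒<λ y₁≤d²
  below-λ (y₁ , y₁∣y , d<y₁ , inj₂ y₁-prime) with den N * y₁ <? Lof N
  ... | yes y₁<λ = y₁ , y₁∣y , d<y₁ , y₁<λ
  ... | no y₁≮λ = q , quotient-∣ y₁∣y , d<q , ≤D⇒<λ q≤D
    where
    q : ℕ
    q = quotient y₁∣y
    instance
      y-nonZero = >-nonZero (≤-<-trans z≤n d<y)
      y₁-nonZero = >-nonZero (≤-<-trans z≤n d<y₁)

    q≤D : q ≤ den N
    q≤D = *-cancelʳ-≤ q (den N) y₁
      (≤-trans (≤-reflexive (sym (m∣n⇒n≡quotient*m y₁∣y))) (≤-trans y≤L (≮⇒≥ y₁≮λ)))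

    d<q : d < q
    d<q with d <? q
    ... | yes d<q = d<q
    ... | no d≮q = ⊥-elim (not-prime-times-small
      (y₁ , q , y₁-prime , >-nonZero⁻¹ q {{quotient≢0 y₁∣y}} , ≮⇒≥ d≮q , m∣n⇒n≡m*quotient y₁∣y))
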